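{- Let $\Pi$ be a logic program over a vocabulary $\sigma$, let $\iota\subseteq\sigma$ be a vocabulary with $hd(\Pi)\cap\iota=\emptyset$, and let $X$ be a set of atoms over $\sigma$. Then $X$ is an input answer set of $\Pi$ relative to $\iota$ if and only if there is a model $X\cup X_i$, with $X_i\subseteq\sigma_i^{R(\Pi,\iota)}$, of the constraint formula $\langle IComp(\Pi,\iota)\wedge R(\Pi,\iota),\ \mathcal{B}_{R(\Pi,\iota)},\ \gamma^{R(\Pi,\iota)}\rangle$ over the vocabulary $\sigma\cup\sigma_i^{R(\Pi,\iota)}$ (with regular atoms $\sigma$ and irregular atoms $\sigma_i^{R(\Pi,\iota)}$).
   Context: Logic programs. A program $\Pi$ over a vocabulary (set of atoms) $\sigma$ is a set of rules $a\leftarrow b_1,\ldots,b_\ell,\ not\ b_{\ell+1},\ldots,\ not\ b_m,\ not\ not\ b_{m+1},\ldots,\ not\ not\ b_n$ ($a\in\sigma$ or $\bot$, $b_i\in\sigma$), identified with $B\rightarrow a$ where $B=b_1\wedge\cdots\wedge b_\ell\wedge\neg b_{\ell+1}\wedge\cdots\wedge\neg b_m\wedge\neg\neg b_{m+1}\wedge\cdots\wedge\neg\neg b_n$ is the body, $B^+=\{b_1,\dots,b_\ell\}$ its positive part and the rest its negative part. Sets of atoms are identified with assignments making exactly their atoms true. $hd(\Pi)$: heads that are atoms; $Bodies(\Pi,a)$: bodies of rules with head $a$; $At(F)$: atoms of formula $F$. Reduct $\Pi^X$: delete rules whose negative part $X$ does not satisfy, replace the rest by $a\leftarrow b_1,..,b_\ell$;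 $X$ is an answer set if it is a minimal set satisfying $\Pi^X$. For $\iota\subseteq\sigma$ with $hd(\Pi)\cap\iota=\emptyset$: $X\subseteq\sigma$ is an input answer set of $\Pi$ relative to $\iota$ if it is an answer set of $\Pi\cup\{a.\mid a\in X\cap\iota\}$; $IComp(\Pi,\iota)$ is the conjunction of the rules of $\Pi$ and the implications $a\rightarrow\bigvee_{B\in Bodies(\Pi,a)}B$ for all $a\in\sigma\setminus\iota$ (empty disjunction $=\bot$). Integer linear constraints. The integer lexicon over a set $V$ of variables has domain $\mathbb{Z}$, binary predicate symbols $<,>,\leq,\geq,=,\neq$ and binary function symbols $+,\times$ with their usual meanings over $\mathbb{Z}$. An integer linear constraint is $a_1x_1+\cdots+a_nx_n\bowtie k$ with $a_j,k\in\mathbb{Z}$, $x_j\in V$, $\bowtie\in\{<,>,\leq,\geq,=,\neq\}$; a valuation $\nu:V\to\mathbb{Z}$ satisfies it if the arithmetic relation holds, and satisfies its negation $\neg c$ if $c$ fails. A GCSP is a finite set of such constraints (and negations); a solution is a valuation satisfying all of them. The formula $R(\Pi,\iota)$. For every atom $a$ let $lr_a$ be an integer variable, and for atoms $a,b$ let $|lr_a-1\geq lr_b|$ be a fresh propositional atom not in $\sigma$. $R(\Pi,\iota)$ is the conjunction, over all $a\in\sigma\setminus\iota$, of the formulas $a\rightarrow\bigvee_{a\leftarrow B\in\Pi,\ B^+\setminus\iota\neq\emptyset}\big(B\wedge\bigwedge_{b\in B^+\setminus\iota}|lr_a-1\geq lr_b|\big)\ \vee\ \bigvee_{a\leftarrow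 B\in\Pi,\ B^+\setminus\iota=\emptyset}B$. $\sigma_i^{R(\Pi,\iota)}$ is the set of atoms $|lr_a-1\geq lr_b|$ occurring in $R(\Pi,\iota)$; $\Sigma^{R(\Pi,\iota)}$ is the set of variables occurring in them; $\gamma^{R(\Pi,\iota)}$ maps $|lr_a-1\geq lr_b|$ to the integer linear constraint $lr_a-1\geq lr_b$ (i.e. $lr_a-lr_b\geq 1$); $\mathcal{B}_{R(\Pi,\iota)}$ is the set of all integer linear constraints over the integer lexicon with variables $\Sigma^{R(\Pi,\iota)}$. Constraint formulas. For disjoint vocabularies $\sigma_r$ (regular) and $\sigma_i$ (irregular), a constraint formula $\langle F,\mathcal{B},\gamma\rangle$ over $\sigma_r\cup\sigma_i$ consists of a propositional formula $F$, a set $\mathcal{B}$ of constraints over a lexicon, and an injective $\gamma:\sigma_i\to\mathcal{B}$; $Y\subseteq At(F)$ is a model if $Y$ satisfies $F$ and the GCSP $\{\gamma(a)\mid a\in Y\cap\sigma_i\}\cup\{\neg\gamma(a)\mid a\in(At(F)\cap\sigma_i)\setminus Y\}$ has a solution. -}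

module Defs where

open import Data.Bool using (Bool; true; false; not; _∧_; _∨_; if_then_else_)
open import Data.Nat using (ℕ)
open import Data.Fin using (Fin; _≟_)
open import Data.Integer as ℤ using (ℤ; +_; -_)
open import Data.List using (List; []; _∷_; _++_; map; concatMap; foldr; filterᵇ; null; allFin)
open import Data.List.Relation.Unary.All using (All)
open import Data.List.Membership.Propositional using (_∈_)
open import Data.Maybe using (Maybe; just; nothing)
open import Data.Product using (_×_; ∃; ∃-syntax; _,_)
open import Relation.Nullary using (¬_; ⌊_⌋)
open import Relation.Binary.PropositionalEquality using (_≡_)

-- Vocabulary σ = Fin n.  Sets of atoms = assignments Fin n → Bool.

AtomSet : ℕ → Set
AtomSet n = Fin n → Bool

_⊆_ : ∀ {n} → AtomSet n → AtomSet n → Set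
Y ⊆ X = ∀ a → Y a ≡ true → X a ≡ true

-- a ← b1..bl, not b(l+1)..bm, not not b(m+1)..bn ;  head nothing = ⊥
record Rule (n : ℕ) : Set where
  constructor rule
  field
    head   : Maybe (Fin n)
    pos    : List (Fin n)
    neg    : List (Fin n)
    negneg : List (Fin n)
open Rule public

Program : ℕ → Set
Program n = List (Rule n)

HeadsDisjoint : ∀ {n} → Program n → AtomSet n → Set
HeadsDisjoint Π ι = All (λ r → ∀ a → head r ≡ just a → ι a ≡ false) Π

NegSat : ∀ {n} → AtomSet n → Rule n → Set
NegSat X r = All (λ b → X b ≡ false) (neg r) × All (λ b → X b ≡ true) (negneg r)

HeadSat : ∀ {n} → AtomSet n → Maybe (Fin n) → Set
HeadSat Y (just a) = Y a ≡ true
HeadSat Y nothing  = Data.Empty.⊥ where import Data.Empty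

SatReduct : ∀ {n} → Program n → AtomSet n → AtomSet n → Set
SatReduct Π X Y =
  All (λ r → NegSat X r → All (λ b → Y b ≡ true) (pos r) → HeadSat Y (head r)) Π

AnswerSet : ∀ {n} → Program n → AtomSet n → Set
AnswerSet Π X = SatReduct Π X X × (∀ Y → Y ⊆ X → SatReduct Π X Y → X ⊆ Y)

fact : ∀ {n} → Fin n → Rule n
fact a = rule (just a) [] [] []

InputAnswerSet : ∀ {n} → Program n → AtomSet n → AtomSet n → Set
InputAnswerSet {n} Π ι X =
  AnswerSet (Π ++ map fact (filterᵇ (λ a → X a ∧ ι a) (allFin n))) X

data Atom (n : ℕ) : Set where
  reg : Fin n → Atom n
  irr : Fin n → Fin n → Atom n    -- irregular atom |lr_a - 1 ≥ lr_b|

data Formula (n : ℕ) : Set where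
  ⊤F ⊥F : Formula n
  atom  : Atom n → Formula n
  ¬F_   : Formula n → Formula n
  _∧F_ _∨F_ _⇒F_ : Formula n → Formula n → Formula n

⟦_⟧ : ∀ {n} → Formula n → (Atom n → Bool) → Bool
⟦ ⊤F ⟧ Y = true
⟦ ⊥F ⟧ Y = false
⟦ atom x ⟧ Y = Y x
⟦ ¬F f ⟧ Y = not (⟦ f ⟧ Y)
⟦ f ∧F g ⟧ Y = ⟦ f ⟧ Y ∧ ⟦ g ⟧ Y
⟦ f ∨F g ⟧ Y = ⟦ f ⟧ Y ∨ ⟦ g ⟧ Y
⟦ f ⇒F g ⟧ Y = not (⟦ f ⟧ Y) ∨ ⟦ g ⟧ Y

atoms : ∀ {n} → Formula n → List (Atom n)
atoms ⊤F = []
atoms ⊥F = []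
atoms (atom x) = x ∷ []
atoms (¬F f) = atoms f
atoms (f ∧F g) = atoms f ++ atoms g
atoms (f ∨F g) = atoms f ++ atoms g
atoms (f ⇒F g) = atoms f ++ atoms g

⋀ : ∀ {n} → List (Formula n) → Formula n
⋀ = foldr _∧F_ ⊤F

⋁ : ∀ {n} → List (Formula n) → Formula n
⋁ = foldr _∨F_ ⊥F

body : ∀ {n} → Rule n → Formula n
body r = ⋀ (map (λ b → atom (reg b)) (pos r))
      ∧F (⋀ (map (λ b → ¬F atom (reg b)) (neg r))
      ∧F ⋀ (map (λ b → ¬F ¬F atom (reg b)) (negneg r)))

headF : ∀ {n} → Maybe (Fin n) → Formula n
headF (just a) = atom (reg a)
headF nothing  = ⊥F

ruleF : ∀ {n} → Rule n → Formula n
ruleF r = body r ⇒F headF (head r)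

hasHead : ∀ {n} → Fin n → Rule n → Bool
hasHead a r with head r
... | just c  = ⌊ c ≟ a ⌋
... | nothing = false

rulesFor : ∀ {n} → Program n → Fin n → List (Rule n)
rulesFor Π a = filterᵇ (hasHead a) Π

nonInput : ∀ {n} → AtomSet n → List (Fin n)
nonInput {n} ι = filterᵇ (λ a → not (ι a)) (allFin n)

IComp : ∀ {n} → Program n → AtomSet n → Formula n
IComp Π ι = ⋀ (map ruleF Π)
  ∧F ⋀ (map (λ a → atom (reg a) ⇒F ⋁ (map body (rulesFor Π a))) (nonInput ι))

posOut : ∀ {n} → AtomSet n → Rule n → List (Fin n)
posOut ι r = filterᵇ (λ b → not (ι b)) (pos r)

RForm : ∀ {n} → Program n → AtomSet n → Formula n
RForm Π ι = ⋀ (map clause (nonInput ι))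
  where
  clause : _ → _
  clause a =
    atom (reg a) ⇒F
      (⋁ (map (λ r → body r ∧F ⋀ (map (λ b → atom (irr a b)) (posOut ι r)))
              (filterᵇ (λ r → not (null (posOut ι r))) (rulesFor Π a)))
       ∨F ⋁ (map body (filterᵇ (λ r → null (posOut ι r)) (rulesFor Π a))))

-- Integer linear constraints; variable lr_a is indexed by the atom a

data Rel : Set where
  lt gt le ge eq ne : Rel

record LinCon (n : ℕ) : Set where
  constructor lincon
  field
    terms : List (ℤ × Fin n)
    rel   : Rel
    bound : ℤ
open LinCon public

relSat : Rel → ℤ → ℤ → Set
relSat lt x y = x ℤ.< y
relSat gt x y = x ℤ.> y
relSat le x y = x ℤ.≤ y
relSat ge x y = x ℤ.≥ y
relSat eq x y = x ≡ y
relSat ne x y = ¬ (x ≡ y)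

evalTerms : ∀ {n} → (Fin n → ℤ) → List (ℤ × Fin n) → ℤ
evalTerms ν [] = + 0
evalTerms ν ((c , x) ∷ ts) = c ℤ.* ν x ℤ.+ evalTerms ν ts

SatCon : ∀ {n} → (Fin n → ℤ) → LinCon n → Set
SatCon ν c = relSat (rel c) (evalTerms ν (terms c)) (bound c)

-- γ^R : |lr_a - 1 ≥ lr_b|  ↦  lr_a - lr_b ≥ 1
γR : ∀ {n} → Fin n → Fin n → LinCon n
γR a b = lincon ((+ 1 , a) ∷ (- (+ 1) , b) ∷ []) ge (+ 1)

ConstraintModel : ∀ {n} → Formula n → (Fin n → Fin n → LinCon n) → (Atom n → Bool) → Set
ConstraintModel {n} F γ Y =
  ⟦ F ⟧ Y ≡ true ×
  ∃[ ν ] (∀ a b → irr a b ∈ atoms F →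
            (Y (irr a b) ≡ true  → SatCon ν (γ a b)) ×
            (Y (irr a b) ≡ false → ¬ SatCon ν (γ a b)))

_∪ᵢ_ : ∀ {n} → AtomSet n → (Fin n → Fin n → Bool) → Atom n → Bool
(X ∪ᵢ Xi) (reg a)   = X a
(X ∪ᵢ Xi) (irr a b) = Xi a b

IrrSubset : ∀ {n} → (Fin n → Fin n → Bool) → Formula n → Set
IrrSubset Xi F = ∀ a b → Xi a b ≡ true → irr a b ∈ atoms F

module Submission where

-- Both sides are compared through ranked supports.  A relation ≺ on atoms
-- ranks a support of X when every non-input atom a ∈ X is the head of a rule
-- of Π whose body holds in X and whose non-input positive atoms are ≺-below a.
--   * answerSet-from-support: a model of Π^X with a support ranked by a
--     well-founded ≺ is an input answer set (minimality by ≺-induction).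
--   * support-from-answerSet: an input answer set has a support ranked by
--     derivation times, found by deriving the atoms of X one at a time with
--     the immediate-consequence step of Π^X until the derived set is closed.
--   * ranking-from-model / model-from-ranking: a model of IComp ∧ R yields a
--     support ranked by the integer solution ν, since γR(a,b) holds iff
--     ν b < ν a; conversely a ℤ-ranked support yields a model, taking
--     Xi(a,b) := "ν b < ν a" on the irregular atoms of R.
-- As "<" on the values of ν is well-founded on the finite vocabulary, the
-- theorem follows.

open import Defs
open import Data.Nat using (ℕ)
open import Data.Fin using (Fin)
open import Data.Bool using (Bool)
open import Data.Product using (_×_; ∃-syntax)
open import Function.Bundles using (_⇔_)

open import Data.Bool using (true; false; not; _∧_; _∨_; if_then_else_; T?)
open import Data.Bool.Properties using (T-≡; ∧-identityʳ; not-involutive; not-¬) renaming (_≟_ to _≟ᵇ_)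
open import Data.Empty using (⊥; ⊥-elim)
open import Data.Fin using (zero; suc) renaming (_≟_ to _≟ᶠ_)
open import Data.Fin.Induction using (spo-wellFounded)
open import Data.Integer as ℤ using (ℤ; +_; -_; 1ℤ)
import Data.Integer.Properties as ℤP
open import Data.List using (List; []; _∷_; _++_; map; filterᵇ; null; allFin)
open import Data.List.Membership.Propositional using (_∈_; find)
open import Data.List.Membership.Propositional.Properties
  using (∈-filter⁺; ∈-filter⁻; ∈-map⁺; ∈-++⁺ˡ; ∈-++⁺ʳ; ∈-++⁻; ∈-allFin)
open import Data.List.Relation.Unary.All as All using (All; []; _∷_)
import Data.List.Relation.Unary.All.Properties as AllP
open import Data.List.Relation.Unary.Any using (Any; here; there; any?)
open import Data.Maybe using (Maybe; just; nothing)
open import Data.Nat using (zero; suc; _+_; _≤_; _<_; z≤n; s≤s)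
import Data.Nat.Properties as ℕP
open import Data.Product using (_,_; proj₁; proj₂)
open import Data.Sum as Sum using (_⊎_; inj₁; inj₂)
open import Data.Unit using (⊤; tt)
open import Function using (_∘_; Equivalence)
open import Function.Bundles using (mk⇔)
open import Induction.WellFounded using (WellFounded; Acc; acc)
import Relation.Binary.Construct.On as On
open import Relation.Binary.Definitions using (DecidableEquality)
open import Relation.Binary.PropositionalEquality using (_≡_; refl; sym; trans; cong; cong₂; subst; subst₂)
open import Relation.Nullary using (¬_; Dec; yes; no; ⌊_⌋)
open import Relation.Nullary.Decidable using (_×-dec_; map′; dec-true; isYes≗does)

∧-intro : ∀ {x y} → x ≡ true → y ≡ true → x ∧ y ≡ true
∧-intro refl refl = refl

∧-elim : ∀ {x y} → x ∧ y ≡ true → x ≡ true × y ≡ true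
∧-elim {true}  y≡true = refl , y≡true
∧-elim {false} ()

∨-introˡ : ∀ {x} y → x ≡ true → x ∨ y ≡ true
∨-introˡ _ refl = refl

∨-introʳ : ∀ x {y} → y ≡ true → x ∨ y ≡ true
∨-introʳ true  _      = refl
∨-introʳ false y≡true = y≡true

∨-elim : ∀ {x y} → x ∨ y ≡ true → x ≡ true ⊎ y ≡ true
∨-elim {true}  _      = inj₁ refl
∨-elim {false} y≡true = inj₂ y≡true

⇒-intro : ∀ {x y} → (x ≡ true → y ≡ true) → not x ∨ y ≡ true
⇒-intro {true}  x⇒y = x⇒y refl
⇒-intro {false} _   = refl

⇒-elim : ∀ {x y} → not x ∨ y ≡ true → x ≡ true → y ≡ true
⇒-elim y≡true refl = y≡true

not-intro : ∀ {x} → x ≡ false → not x ≡ true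
not-intro refl = refl

not-elim : ∀ {x} → not x ≡ true → x ≡ false
not-elim {false} _ = refl
not-elim {true}  ()

¬¬-intro : ∀ {x} → x ≡ true → not (not x) ≡ true
¬¬-intro {x} = trans (not-involutive x)

¬¬-elim : ∀ {x} → not (not x) ≡ true → x ≡ true
¬¬-elim {x} = trans (sym (not-involutive x))

witness : ∀ {P : Set} (P? : Dec P) → ⌊ P? ⌋ ≡ true → P
witness (yes p) _ = p

⌊⌋-true : ∀ {P : Set} (P? : Dec P) → P → ⌊ P? ⌋ ≡ true
⌊⌋-true P? p = trans (isYes≗does P?) (dec-true P? p)

∈-filterᵇ⁺ : ∀ {A : Set} (p : A → Bool) {x xs} → x ∈ xs → p x ≡ true → x ∈ filterᵇ p xs
∈-filterᵇ⁺ p x∈xs px = ∈-filter⁺ (T? ∘ p) x∈xs (Equivalence.from T-≡ px)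

∈-filterᵇ⁻ : ∀ {A : Set} (p : A → Bool) {x xs} → x ∈ filterᵇ p xs → x ∈ xs × p x ≡ true
∈-filterᵇ⁻ p x∈ with ∈-filter⁻ (T? ∘ p) x∈
... | x∈xs , px = x∈xs , Equivalence.to T-≡ px

null⇒All : ∀ {A : Set} {P : A → Set} {xs} → null xs ≡ true → All P xs
null⇒All {xs = []} _ = []

_≟ₐ_ : ∀ {n} → DecidableEquality (Atom n)
reg a   ≟ₐ reg b   = map′ (cong reg) (λ { refl → refl }) (a ≟ᶠ b)
irr a b ≟ₐ irr c d =
  map′ (λ { (refl , refl) → refl }) (λ { refl → refl , refl }) (a ≟ᶠ c ×-dec b ≟ᶠ d)
reg _   ≟ₐ irr _ _ = no λ ()
irr _ _ ≟ₐ reg _   = no λ ()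

_∈?_ : ∀ {n} (x : Atom n) xs → Dec (x ∈ xs)
x ∈? xs = any? (x ≟ₐ_) xs

-- The number of atoms in a set: the progress measure of the derivation.

indicator : Bool → ℕ
indicator true  = 1
indicator false = 0

size : ∀ {n} → AtomSet n → ℕ
size {zero}  Y = 0
size {suc n} Y = indicator (Y zero) + size (Y ∘ suc)

indicator-mono : ∀ {x y} → (x ≡ true → y ≡ true) → indicator x ≤ indicator y
indicator-mono {false} _   = z≤n
indicator-mono {true}  x⇒y rewrite x⇒y refl = ℕP.≤-refl

size-mono : ∀ {n} {Y Z : AtomSet n} → Y ⊆ Z → size Y ≤ size Z
size-mono {zero}  _   = z≤n
size-mono {suc n} Y⊆Z = ℕP.+-mono-≤ (indicator-mono (Y⊆Z zero)) (size-mono (Y⊆Z ∘ suc))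

size-grows : ∀ {n} {Y Z : AtomSet n} → Y ⊆ Z → ∀ a → Y a ≡ false → Z a ≡ true → size Y < size Z
size-grows {suc n} Y⊆Z zero    Ya Za rewrite Ya | Za = s≤s (size-mono (Y⊆Z ∘ suc))
size-grows {suc n} Y⊆Z (suc a) Ya Za =
  ℕP.+-mono-≤-< (indicator-mono (Y⊆Z zero)) (size-grows (Y⊆Z ∘ suc) a Ya Za)

-- Comparing the values of ν : Fin n → ℤ is a well-founded relation on the
-- finitely many atoms (every strict partial order on Fin n is).
ranking-wellFounded : ∀ {n} (ν : Fin n → ℤ) → WellFounded (λ b a → ν b ℤ.< ν a)
ranking-wellFounded ν = spo-wellFounded (On.isStrictPartialOrder ν ℤP.<-isStrictPartialOrder)

γR-value : ∀ {n} (ν : Fin n → ℤ) a b → evalTerms ν (terms (γR a b)) ≡ ν a ℤ.- ν b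
γR-value ν a b = cong₂ ℤ._+_ (ℤP.*-identityˡ (ν a)) (trans (ℤP.+-identityʳ _) (ℤP.-1*i≡-i (ν b)))

γR-sound : ∀ {n} (ν : Fin n → ℤ) {a b} → SatCon ν (γR a b) → ν b ℤ.< ν a
γR-sound ν {a} {b} sat = ℤP.suc[i]≤j⇒i<j (begin
  1ℤ ℤ.+ ν b               ≤⟨ ℤP.+-monoˡ-≤ (ν b) (subst (1ℤ ℤ.≤_) (γR-value ν a b) sat) ⟩
  ν a ℤ.- ν b ℤ.+ ν b      ≡⟨ ℤP.+-assoc (ν a) (- ν b) (ν b) ⟩
  ν a ℤ.+ (- ν b ℤ.+ ν b)  ≡⟨ cong (λ z → ν a ℤ.+ z) (ℤP.+-inverseˡ (ν b)) ⟩
  ν a ℤ.+ + 0              ≡⟨ ℤP.+-identityʳ (ν a) ⟩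
  ν a                      ∎)
  where open ℤP.≤-Reasoning

γR-complete : ∀ {n} (ν : Fin n → ℤ) {a b} → ν b ℤ.< ν a → SatCon ν (γR a b)
γR-complete ν {a} {b} b<a = subst (1ℤ ℤ.≤_) (sym (γR-value ν a b)) (begin
  1ℤ                       ≡⟨ sym (ℤP.+-identityʳ 1ℤ) ⟩
  1ℤ ℤ.+ + 0               ≡⟨ cong (λ z → 1ℤ ℤ.+ z) (sym (ℤP.+-inverseʳ (ν b))) ⟩
  1ℤ ℤ.+ (ν b ℤ.- ν b)     ≡⟨ sym (ℤP.+-assoc 1ℤ (ν b) (- ν b)) ⟩
  1ℤ ℤ.+ ν b ℤ.- ν b       ≤⟨ ℤP.+-monoˡ-≤ (- ν b) (ℤP.i<j⇒suc[i]≤j b<a) ⟩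
  ν a ℤ.- ν b              ∎)
  where open ℤP.≤-Reasoning

module _ {n : ℕ} (Y : Atom n → Bool) where

  ⋀-intro : ∀ {A : Set} (g : A → Formula n) xs →
            All (λ x → ⟦ g x ⟧ Y ≡ true) xs → ⟦ ⋀ (map g xs) ⟧ Y ≡ true
  ⋀-intro g []       []         = refl
  ⋀-intro g (x ∷ xs) (gx ∷ gxs) = ∧-intro gx (⋀-intro g xs gxs)

  ⋀-elim : ∀ {A : Set} (g : A → Formula n) xs →
           ⟦ ⋀ (map g xs) ⟧ Y ≡ true → All (λ x → ⟦ g x ⟧ Y ≡ true) xs
  ⋀-elim g []       _     = []
  ⋀-elim g (x ∷ xs) holds with ∧-elim {⟦ g x ⟧ Y} holds
  ... | gx , gxs = gx ∷ ⋀-elim g xs gxs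

  ⋁-intro : ∀ {A : Set} (g : A → Formula n) {x} xs →
            x ∈ xs → ⟦ g x ⟧ Y ≡ true → ⟦ ⋁ (map g xs) ⟧ Y ≡ true
  ⋁-intro g (y ∷ xs) (here refl) gx = ∨-introˡ _ gx
  ⋁-intro g (y ∷ xs) (there x∈)  gx = ∨-introʳ (⟦ g y ⟧ Y) (⋁-intro g xs x∈ gx)

  ⋁-elim : ∀ {A : Set} (g : A → Formula n) xs →
           ⟦ ⋁ (map g xs) ⟧ Y ≡ true → ∃[ x ] (x ∈ xs × ⟦ g x ⟧ Y ≡ true)
  ⋁-elim g (y ∷ xs) holds with ∨-elim {⟦ g y ⟧ Y} holds
  ... | inj₁ gy  = y , here refl , gy
  ... | inj₂ gxs with ⋁-elim g xs gxs
  ...   | x , x∈ , gx = x , there x∈ , gx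

agree : ∀ {n} (f : Formula n) (Y Y′ : Atom n → Bool) →
        (∀ x → x ∈ atoms f → Y x ≡ Y′ x) → ⟦ f ⟧ Y ≡ ⟦ f ⟧ Y′
agree ⊤F       Y Y′ same = refl
agree ⊥F       Y Y′ same = refl
agree (atom x) Y Y′ same = same x (here refl)
agree (¬F f)   Y Y′ same = cong not (agree f Y Y′ same)
agree (f ∧F g) Y Y′ same = cong₂ _∧_ (agree f Y Y′ (λ x → same x ∘ ∈-++⁺ˡ))
                                     (agree g Y Y′ (λ x → same x ∘ ∈-++⁺ʳ (atoms f)))
agree (f ∨F g) Y Y′ same = cong₂ _∨_ (agree f Y Y′ (λ x → same x ∘ ∈-++⁺ˡ))
                                     (agree g Y Y′ (λ x → same x ∘ ∈-++⁺ʳ (atoms f)))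
agree (f ⇒F g) Y Y′ same = cong₂ (λ u v → not u ∨ v) (agree f Y Y′ (λ x → same x ∘ ∈-++⁺ˡ))
                                                     (agree g Y Y′ (λ x → same x ∘ ∈-++⁺ʳ (atoms f)))

-- A formula is regular if all its atoms lie in σ.  IComp(Π,ι) is regular,
-- so every irregular atom of IComp ∧ R is an atom of R.

IsRegular : ∀ {n} → Atom n → Set
IsRegular (reg _)   = ⊤
IsRegular (irr _ _) = ⊥

Regular : ∀ {n} → Formula n → Set
Regular f = All IsRegular (atoms f)

regular-⋀ : ∀ {n} {A : Set} (g : A → Formula n) xs → (∀ x → Regular (g x)) → Regular (⋀ (map g xs))
regular-⋀ g []       _       = []
regular-⋀ g (x ∷ xs) regular = AllP.++⁺ (regular x) (regular-⋀ g xs regular)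

regular-⋁ : ∀ {n} {A : Set} (g : A → Formula n) xs → (∀ x → Regular (g x)) → Regular (⋁ (map g xs))
regular-⋁ g []       _       = []
regular-⋁ g (x ∷ xs) regular = AllP.++⁺ (regular x) (regular-⋁ g xs regular)

regular-body : ∀ {n} (r : Rule n) → Regular (body r)
regular-body r = AllP.++⁺ (regular-⋀ _ (pos r) (λ _ → tt ∷ []))
                          (AllP.++⁺ (regular-⋀ _ (neg r) (λ _ → tt ∷ []))
                                    (regular-⋀ _ (negneg r) (λ _ → tt ∷ [])))

regular-headF : ∀ {n} (h : Maybe (Fin n)) → Regular (headF h)
regular-headF (just _) = tt ∷ []
regular-headF nothing  = []

regular-IComp : ∀ {n} (Π : Program n) ι → Regular (IComp Π ι)
regular-IComp Π ι = AllP.++⁺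
  (regular-⋀ ruleF Π (λ r → AllP.++⁺ (regular-body r) (regular-headF (head r))))
  (regular-⋀ _ (nonInput ι) (λ a → tt ∷ regular-⋁ body (rulesFor Π a) regular-body))

irr-in-R : ∀ {n} (Π : Program n) ι {a b} →
           irr a b ∈ atoms (IComp Π ι ∧F RForm Π ι) → irr a b ∈ atoms (RForm Π ι)
irr-in-R Π ι m with ∈-++⁻ (atoms (IComp Π ι)) m
... | inj₁ inIComp = ⊥-elim (All.lookup (regular-IComp Π ι) inIComp)
... | inj₂ inR     = inR

BodyHolds : ∀ {n} → AtomSet n → Rule n → Set
BodyHolds X r = All (λ b → X b ≡ true) (pos r) × NegSat X r

module _ {n : ℕ} (X : AtomSet n) (Xi : Fin n → Fin n → Bool) where

  body-true⁺ : ∀ r → BodyHolds X r → ⟦ body r ⟧ (X ∪ᵢ Xi) ≡ true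
  body-true⁺ r (ps , ns , nns) =
    ∧-intro (⋀-intro _ _ (pos r) ps)
            (∧-intro (⋀-intro _ _ (neg r) (All.map not-intro ns))
                     (⋀-intro _ _ (negneg r) (All.map ¬¬-intro nns)))

  body-true⁻ : ∀ r → ⟦ body r ⟧ (X ∪ᵢ Xi) ≡ true → BodyHolds X r
  body-true⁻ r holds with ∧-elim {⟦ ⋀ (map (λ b → atom (reg b)) (pos r)) ⟧ (X ∪ᵢ Xi)} holds
  ... | ps , rest with ∧-elim {⟦ ⋀ (map (λ b → ¬F atom (reg b)) (neg r)) ⟧ (X ∪ᵢ Xi)} rest
  ...   | ns , nns = ⋀-elim _ _ (pos r) ps
                   , All.map not-elim (⋀-elim _ _ (neg r) ns)
                   , All.map ¬¬-elim (⋀-elim _ _ (negneg r) nns)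

  head-true⁺ : ∀ h → HeadSat X h → ⟦ headF h ⟧ (X ∪ᵢ Xi) ≡ true
  head-true⁺ (just a) sat = sat

  head-true⁻ : ∀ h → ⟦ headF h ⟧ (X ∪ᵢ Xi) ≡ true → HeadSat X h
  head-true⁻ (just a) holds = holds
  head-true⁻ nothing  ()

∈-rulesFor⁺ : ∀ {n} {Π : Program n} {a r} → r ∈ Π → head r ≡ just a → r ∈ rulesFor Π a
∈-rulesFor⁺ {a = a} {r = rule (just c) _ _ _} r∈Π refl =
  ∈-filterᵇ⁺ (hasHead a) r∈Π (⌊⌋-true (a ≟ᶠ a) refl)

∈-rulesFor⁻ : ∀ {n} {Π : Program n} {a r} → r ∈ rulesFor Π a → r ∈ Π × head r ≡ just a
∈-rulesFor⁻ {a = a} {r} r∈ with ∈-filterᵇ⁻ (hasHead a) r∈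
... | r∈Π , hasHead-a = r∈Π , head≡ r hasHead-a
  where
  head≡ : ∀ r → hasHead a r ≡ true → head r ≡ just a
  head≡ (rule (just c) _ _ _) same = cong just (witness (c ≟ᶠ a) same)

∈-nonInput⁺ : ∀ {n} {ι : AtomSet n} {a} → ι a ≡ false → a ∈ nonInput ι
∈-nonInput⁺ {a = a} ιa = ∈-filterᵇ⁺ _ (∈-allFin a) (not-intro ιa)

∈-nonInput⁻ : ∀ {n} {ι : AtomSet n} {a} → a ∈ nonInput ι → ι a ≡ false
∈-nonInput⁻ {ι = ι} a∈ = not-elim (proj₂ (∈-filterᵇ⁻ (λ a → not (ι a)) {xs = allFin _} a∈))

∈-posOut⁺ : ∀ {n} {ι : AtomSet n} {r b} → b ∈ pos r → ι b ≡ false → b ∈ posOut ι r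
∈-posOut⁺ b∈ ιb = ∈-filterᵇ⁺ _ b∈ (not-intro ιb)

∈-posOut⁻ : ∀ {n} {ι : AtomSet n} {r b} → b ∈ posOut ι r → b ∈ pos r × ι b ≡ false
∈-posOut⁻ b∈ with ∈-filterᵇ⁻ _ b∈
... | b∈pos , not-ιb = b∈pos , not-elim not-ιb

module _ {n : ℕ} (Π : Program n) (ι X : AtomSet n) where

  ReductSat : AtomSet n → Rule n → Set
  ReductSat Y r = NegSat X r → All (λ b → Y b ≡ true) (pos r) → HeadSat Y (head r)

  reduct-holds : InputAnswerSet Π ι X → SatReduct Π X X
  reduct-holds (sat , _) = AllP.++⁻ˡ Π sat

  inputFacts : Program n
  inputFacts = map fact (filterᵇ (λ a → X a ∧ ι a) (allFin n))

  ContainsInputs : AtomSet n → Set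
  ContainsInputs Y = ∀ a → X a ≡ true → ι a ≡ true → Y a ≡ true

  inputFacts-sat⁺ : ∀ {Y} → ContainsInputs Y → SatReduct inputFacts X Y
  inputFacts-sat⁺ inputs = AllP.map⁺ (All.tabulate λ a∈ _ _ →
    let (Xa , ιa) = ∧-elim (proj₂ (∈-filterᵇ⁻ (λ a → X a ∧ ι a) {xs = allFin n} a∈)) in inputs _ Xa ιa)

  inputFacts-sat⁻ : ∀ {Y} → SatReduct inputFacts X Y → ContainsInputs Y
  inputFacts-sat⁻ sat a Xa ιa =
    All.lookup sat (∈-map⁺ fact (∈-filterᵇ⁺ _ (∈-allFin a) (∧-intro Xa ιa))) ([] , []) []

  record Support (a : Fin n) (Below : Fin n → Set) : Set where
    field
      by    : Rule n
      by∈Π  : by ∈ Π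
      head≡ : head by ≡ just a
      fires : BodyHolds X by
      below : All Below (posOut ι by)

  support-map : ∀ {a} {P Q : Fin n → Set} → (∀ {b} → P b → Q b) → Support a P → Support a Q
  support-map P⇒Q s = record { Support s; below = All.map P⇒Q (Support.below s) }

  support-from-rule : ∀ {a r} {Below : Fin n → Set} → r ∈ rulesFor Π a → BodyHolds X r →
                      All Below (posOut ι r) → Support a Below
  support-from-rule {a} {r} r∈ fires below = record
    { by = r ; by∈Π = proj₁ r∈Π×head≡ ; head≡ = proj₂ r∈Π×head≡ ; fires = fires ; below = below }
    where
    r∈Π×head≡ : r ∈ Π × head r ≡ just a
    r∈Π×head≡ = ∈-rulesFor⁻ {Π = Π} r∈

  Supported : (Fin n → Fin n → Set) → Set
  Supported _≺_ = ∀ a → X a ≡ true → ι a ≡ false → Support a (_≺ a)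

  supported-map : ∀ {P Q : Fin n → Fin n → Set} → (∀ {b a} → P b a → Q b a) → Supported P → Supported Q
  supported-map P⇒Q sup a Xa ιa = support-map P⇒Q (sup a Xa ιa)

  answerSet-from-support : ∀ {_≺_} → WellFounded _≺_ → SatReduct Π X X → Supported _≺_ →
                           InputAnswerSet Π ι X
  answerSet-from-support {_≺_} wf sat sup = AllP.++⁺ sat (inputFacts-sat⁺ (λ _ Xa _ → Xa)) , minimal
    where
    minimal : ∀ Y → Y ⊆ X → SatReduct (Π ++ inputFacts) X Y → X ⊆ Y
    minimal Y _ satY a = reach (wf a)
      where
      inputs : ContainsInputs Y
      inputs = inputFacts-sat⁻ (AllP.++⁻ʳ Π satY)

      reach : ∀ {a} → Acc _≺_ a → X a ≡ true → Y a ≡ true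
      reach {a} (acc smaller) Xa with ι a in ιa
      ... | true  = inputs a Xa ιa
      ... | false = subst (HeadSat Y) head≡
                      (All.lookup (AllP.++⁻ˡ Π satY) by∈Π (proj₂ fires) (All.tabulate posInY))
        where
        open Support (sup a Xa ιa)
        posInY : ∀ {b} → b ∈ pos by → Y b ≡ true
        posInY {b} b∈ with ι b in ιb
        ... | true  = inputs b (All.lookup (proj₁ fires) b∈) ιb
        ... | false = reach (smaller (All.lookup below (∈-posOut⁺ {ι = ι} {r = by} b∈ ιb)))
                            (All.lookup (proj₁ fires) b∈)

  FiresOutside : AtomSet n → Rule n → Set
  FiresOutside D r = NegSat X r × All (λ b → D b ≡ true) (pos r) × ∃[ a ] (head r ≡ just a × D a ≡ false)

  negSat? : ∀ r → Dec (NegSat X r)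
  negSat? r = All.all? (λ b → X b ≟ᵇ false) (neg r) ×-dec All.all? (λ b → X b ≟ᵇ true) (negneg r)

  -- For D ⊆ X, either D satisfies the reduct of r or r fires outside D
  -- (a constraint cannot fire, as X satisfies its reduct).
  check-rule : ∀ {D} → D ⊆ X → ∀ r → ReductSat X r → ReductSat D r ⊎ FiresOutside D r
  check-rule {D} D⊆X r satX with negSat? r ×-dec All.all? (λ b → D b ≟ᵇ true) (pos r)
  ... | no ¬fires     = inj₁ λ ns ps → ⊥-elim (¬fires (ns , ps))
  ... | yes (ns , ps) = Sum.map (λ inD _ _ → inD) (λ out → ns , ps , out)
                                (check-head (head r) (satX ns (All.map (D⊆X _) ps)))
    where
    check-head : ∀ h → HeadSat X h → HeadSat D h ⊎ ∃[ a ] (h ≡ just a × D a ≡ false)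
    check-head (just a) _ with D a in Da
    ... | true  = inj₁ refl
    ... | false = inj₂ (a , refl , Da)

  check-program : ∀ {D} → D ⊆ X → ∀ rs → All (ReductSat X) rs →
                  All (ReductSat D) rs ⊎ Any (FiresOutside D) rs
  check-program D⊆X []       []             = inj₁ []
  check-program D⊆X (r ∷ rs) (satr ∷ satrs) with check-rule D⊆X r satr | check-program D⊆X rs satrs
  ... | inj₂ out | _         = inj₂ (here out)
  ... | inj₁ _   | inj₂ outs = inj₂ (there outs)
  ... | inj₁ inD | inj₁ inDs = inj₁ (inD ∷ inDs)

  -- A stage of the bottom-up derivation of X: a set D ⊆ X of derived atoms
  -- containing the inputs, together with derivation times below size D, such
  -- that every non-input atom of D is supported by atoms derived before it.
  record Stage : Set where
    field
      D         : AtomSet n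
      time      : Fin n → ℕ
      D⊆X       : D ⊆ X
      inputs    : ContainsInputs D
      time<size : ∀ a → D a ≡ true → ι a ≡ false → time a < size D
      derived   : ∀ a → D a ≡ true → ι a ≡ false → Support a (λ b → D b ≡ true × time b < time a)

  initial : Stage
  initial = record
    { D         = λ a → X a ∧ ι a
    ; time      = λ _ → 0
    ; D⊆X       = λ a Da → proj₁ (∧-elim Da)
    ; inputs    = λ a Xa ιa → ∧-intro Xa ιa
    ; time<size = λ a Da ιa → ⊥-elim (inputNonInput Da ιa)
    ; derived   = λ a Da ιa → ⊥-elim (inputNonInput Da ιa)
    }
    where
    inputNonInput : ∀ {a} → X a ∧ ι a ≡ true → ι a ≡ false → ⊥
    inputNonInput Da ιa with () ← trans (sym (proj₂ (∧-elim Da))) ιa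

  module Derivation (satΠ : SatReduct Π X X) where

    -- One derivation step: the head a of a rule r firing outside D is added
    -- with time size D, later than every atom already derived.
    module Extension (s : Stage) {r : Rule n} (r∈Π : r ∈ Π)
                     (ns : NegSat X r) (ps : All (λ b → Stage.D s b ≡ true) (pos r))
                     {a : Fin n} (head≡a : head r ≡ just a) (a∉D : Stage.D s a ≡ false) where
      open Stage s

      Xa : X a ≡ true
      Xa = subst (HeadSat X) head≡a (All.lookup satΠ r∈Π ns (All.map (D⊆X _) ps))

      D′ : AtomSet n
      D′ x = D x ∨ ⌊ x ≟ᶠ a ⌋

      time′ : Fin n → ℕ
      time′ x = if D x then time x else size D

      old∈D′ : ∀ {x} → D x ≡ true → D′ x ≡ true
      old∈D′ Dx = ∨-introˡ _ Dx

      a∈D′ : D′ a ≡ true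
      a∈D′ = ∨-introʳ (D a) (⌊⌋-true (a ≟ᶠ a) refl)

      D′-cases : ∀ {x} → D′ x ≡ true → D x ≡ true ⊎ x ≡ a
      D′-cases {x} D′x = Sum.map₂ (witness (x ≟ᶠ a)) (∨-elim D′x)

      time-old : ∀ {x} → D x ≡ true → time′ x ≡ time x
      time-old Dx rewrite Dx = refl

      time-new : time′ a ≡ size D
      time-new rewrite a∉D = refl

      grows : size D < size D′
      grows = size-grows (λ _ → old∈D′) a a∉D a∈D′

      -- Times of old atoms are unchanged, so their supports remain valid.
      keep : ∀ {x b} → D x ≡ true → D b ≡ true × time b < time x → D′ b ≡ true × time′ b < time′ x
      keep Dx (Db , b<x) = old∈D′ Db , subst₂ _<_ (sym (time-old Db)) (sym (time-old Dx)) b<x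

      -- The rule r supports a, as its non-input positive atoms are older.
      new-support : Support a (λ b → D′ b ≡ true × time′ b < time′ a)
      new-support = record
        { by = r ; by∈Π = r∈Π ; head≡ = head≡a ; fires = All.map (D⊆X _) ps , ns
        ; below = All.tabulate λ b∈ →
            let (b∈pos , ιb) = ∈-posOut⁻ {ι = ι} {r = r} b∈
                Db = All.lookup ps b∈pos
            in old∈D′ Db , subst₂ _<_ (sym (time-old Db)) (sym time-new) (time<size _ Db ιb)
        }

      stage : Stage
      stage = record
        { D         = D′
        ; time      = time′
        ; D⊆X       = λ x D′x → Sum.[ D⊆X x , (λ { refl → Xa }) ] (D′-cases D′x)
        ; inputs    = λ x Xx ιx → old∈D′ (inputs x Xx ιx)
        ; time<size = λ x D′x ιx → Sum.[ (λ Dx → subst (_< size D′) (sym (time-old Dx))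
                                                        (ℕP.<-trans (time<size x Dx ιx) grows))
                                        , (λ { refl → subst (_< size D′) (sym time-new) grows }) ] (D′-cases D′x)
        ; derived   = λ x D′x ιx → Sum.[ (λ Dx → support-map (keep Dx) (derived x Dx ιx))
                                        , (λ { refl → new-support }) ] (D′-cases D′x)
        }

    step : (s : Stage) → SatReduct Π X (Stage.D s) ⊎ ∃[ s′ ] (size (Stage.D s) < size (Stage.D s′))
    step s with check-program (Stage.D⊆X s) Π satΠ
    ... | inj₁ closed = inj₁ closed
    ... | inj₂ outside with find outside
    ...   | r , r∈Π , (ns , ps , a , head≡a , a∉D) = inj₂ (E.stage , E.grows)
      where module E = Extension s r∈Π ns ps head≡a a∉D

    -- Iterating the step reaches a stage satisfying Π^X, since stages grow
    -- inside X; k bounds the number of remaining steps.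
    saturate : ∀ k (s : Stage) → size X ≤ k + size (Stage.D s) → ∃[ s ] SatReduct Π X (Stage.D s)
    saturate k s bound with step s
    ... | inj₁ closed = s , closed
    saturate zero s bound | inj₂ (s′ , grows) = ⊥-elim (ℕP.<-irrefl refl (begin-strict
      size X               ≤⟨ bound ⟩
      size (Stage.D s)     <⟨ grows ⟩
      size (Stage.D s′)    ≤⟨ size-mono (Stage.D⊆X s′) ⟩
      size X               ∎))
      where open ℕP.≤-Reasoning
    saturate (suc k) s bound | inj₂ (s′ , grows) = saturate k s′ (begin
      size X                       ≤⟨ bound ⟩
      suc k + size (Stage.D s)     ≡⟨ sym (ℕP.+-suc k _) ⟩
      k + suc (size (Stage.D s))   ≤⟨ ℕP.+-monoʳ-≤ k grows ⟩
      k + size (Stage.D s′)        ∎)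
      where open ℕP.≤-Reasoning

  -- An input answer set has a support ranked by derivation times: by
  -- minimality the saturated stage contains X.
  support-from-answerSet : InputAnswerSet Π ι X → ∃[ time ] Supported (λ b a → time b < time a)
  support-from-answerSet answerSet@(_ , minimal) =
    Stage.time s , λ a Xa ιa → support-map proj₂ (Stage.derived s a (X⊆D a Xa) ιa)
    where
    saturated : ∃[ s ] SatReduct Π X (Stage.D s)
    saturated = Derivation.saturate (reduct-holds answerSet) (size X) initial (ℕP.m≤m+n (size X) _)
    s : Stage
    s = proj₁ saturated
    X⊆D : X ⊆ Stage.D s
    X⊆D = minimal (Stage.D s) (Stage.D⊆X s) (AllP.++⁺ (proj₂ saturated) (inputFacts-sat⁺ (Stage.inputs s)))

  guardedRules plainRules : Fin n → List (Rule n)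
  guardedRules a = filterᵇ (λ r → not (null (posOut ι r))) (rulesFor Π a)
  plainRules   a = filterᵇ (λ r → null (posOut ι r)) (rulesFor Π a)

  guarded : Fin n → Rule n → Formula n
  guarded a r = body r ∧F ⋀ (map (λ b → atom (irr a b)) (posOut ι r))

  justification : Fin n → Formula n
  justification a = ⋁ (map (guarded a) (guardedRules a)) ∨F ⋁ (map body (plainRules a))

  module _ (Xi : Fin n → Fin n → Bool) where

    icomp-reduct : ⟦ IComp Π ι ⟧ (X ∪ᵢ Xi) ≡ true → SatReduct Π X X
    icomp-reduct holds = All.map ruleSat (⋀-elim _ ruleF Π (proj₁ (∧-elim holds)))
      where
      ruleSat : ∀ {r} → ⟦ ruleF r ⟧ (X ∪ᵢ Xi) ≡ true → ReductSat X r
      ruleSat {r} holds ns ps = head-true⁻ X Xi (head r) (⇒-elim holds (body-true⁺ X Xi r (ps , ns)))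

    icomp-true : ∀ {P} → SatReduct Π X X → Supported P → ⟦ IComp Π ι ⟧ (X ∪ᵢ Xi) ≡ true
    icomp-true sat sup = ∧-intro (⋀-intro _ ruleF Π (All.map ruleTrue sat))
                                 (⋀-intro _ _ (nonInput ι) (All.tabulate completionTrue))
      where
      ruleTrue : ∀ {r} → ReductSat X r → ⟦ ruleF r ⟧ (X ∪ᵢ Xi) ≡ true
      ruleTrue {r} satr = ⇒-intro λ bodyTrue →
        let (ps , ns) = body-true⁻ X Xi r bodyTrue in head-true⁺ X Xi (head r) (satr ns ps)
      completionTrue : ∀ {a} → a ∈ nonInput ι →
                       ⟦ atom (reg a) ⇒F ⋁ (map body (rulesFor Π a)) ⟧ (X ∪ᵢ Xi) ≡ true
      completionTrue a∈ = ⇒-intro λ Xa → let open Support (sup _ Xa (∈-nonInput⁻ a∈)) in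
        ⋁-intro _ body _ (∈-rulesFor⁺ by∈Π head≡) (body-true⁺ X Xi by fires)

    rform-support : ⟦ RForm Π ι ⟧ (X ∪ᵢ Xi) ≡ true → Supported (λ b a → Xi a b ≡ true)
    rform-support holds a Xa ιa = Sum.[ from-guarded , from-plain ]
      (∨-elim (⇒-elim (All.lookup (⋀-elim _ _ (nonInput ι) holds) (∈-nonInput⁺ ιa)) Xa))
      where
      from-guarded : ⟦ ⋁ (map (guarded a) (guardedRules a)) ⟧ (X ∪ᵢ Xi) ≡ true →
                     Support a (λ b → Xi a b ≡ true)
      from-guarded holds with ⋁-elim _ (guarded a) (guardedRules a) holds
      ... | r , r∈ , rTrue with ∧-elim {⟦ body r ⟧ (X ∪ᵢ Xi)} rTrue
      ...   | bodyTrue , belowTrue = support-from-rule (proj₁ (∈-filterᵇ⁻ _ r∈))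
                                       (body-true⁻ X Xi r bodyTrue) (⋀-elim _ _ (posOut ι r) belowTrue)

      from-plain : ⟦ ⋁ (map body (plainRules a)) ⟧ (X ∪ᵢ Xi) ≡ true → Support a (λ b → Xi a b ≡ true)
      from-plain holds with ⋁-elim _ body (plainRules a) holds
      ... | r , r∈ , bodyTrue with ∈-filterᵇ⁻ _ r∈
      ...   | r∈a , noOut = support-from-rule r∈a (body-true⁻ X Xi r bodyTrue) (null⇒All noOut)

    rform-true : Supported (λ b a → Xi a b ≡ true) → ⟦ RForm Π ι ⟧ (X ∪ᵢ Xi) ≡ true
    rform-true sup = ⋀-intro _ _ (nonInput ι) (All.tabulate λ a∈ → ⇒-intro λ Xa →
      justification-true (sup _ Xa (∈-nonInput⁻ a∈)))
      where
      justification-true : ∀ {a} → Support a (λ b → Xi a b ≡ true) →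
                           ⟦ justification a ⟧ (X ∪ᵢ Xi) ≡ true
      justification-true {a} s = byDisjunct
        where
        open Support s
        r∈a : by ∈ rulesFor Π a
        r∈a = ∈-rulesFor⁺ by∈Π head≡
        bodyTrue : ⟦ body by ⟧ (X ∪ᵢ Xi) ≡ true
        bodyTrue = body-true⁺ X Xi by fires
        byDisjunct : ⟦ justification a ⟧ (X ∪ᵢ Xi) ≡ true
        byDisjunct with null (posOut ι by) in noOut
        ... | true  = ∨-introʳ _ (⋁-intro _ body _
                        (∈-filterᵇ⁺ (λ r → null (posOut ι r)) r∈a noOut) bodyTrue)
        ... | false = ∨-introˡ _ (⋁-intro _ (guarded a) _
                        (∈-filterᵇ⁺ (λ r → not (null (posOut ι r))) r∈a (cong not noOut))
                        (∧-intro bodyTrue (⋀-intro _ _ (posOut ι by) below)))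

  ModelWith : (Fin n → Fin n → Bool) → Set
  ModelWith Xi = IrrSubset Xi (RForm Π ι) × ConstraintModel (IComp Π ι ∧F RForm Π ι) γR (X ∪ᵢ Xi)

  ranking-from-model : ∃[ Xi ] ModelWith Xi → SatReduct Π X X × ∃[ ν ] Supported (λ b a → ν b ℤ.< ν a)
  ranking-from-model (Xi , Xi⊆R , holds , ν , solves) with ∧-elim {⟦ IComp Π ι ⟧ (X ∪ᵢ Xi)} holds
  ... | icompTrue , rformTrue =
    icomp-reduct Xi icompTrue , ν , supported-map decreasing (rform-support Xi rformTrue)
    where
    decreasing : ∀ {b a} → Xi a b ≡ true → ν b ℤ.< ν a
    decreasing {b} {a} Xab =
      γR-sound ν (proj₁ (solves a b (∈-++⁺ʳ (atoms (IComp Π ι)) (Xi⊆R a b Xab))) Xab)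

  -- Conversely a ℤ-ranked support yields a model: take Xi(a,b) true iff
  -- |lr_a - 1 ≥ lr_b| occurs in R and ν b < ν a.
  model-from-ranking : (ν : Fin n → ℤ) → SatReduct Π X X → Supported (λ b a → ν b ℤ.< ν a) →
                       ∃[ Xi ] ModelWith Xi
  model-from-ranking ν sat sup = Xi , Xi⊆R , ∧-intro (icomp-true Xi sat sup) rformTrue , ν , solves
    where
    ranksBelow : Fin n → Fin n → Bool
    ranksBelow a b = ⌊ ν b ℤP.<? ν a ⌋

    inR? : ∀ a b → Dec (irr a b ∈ atoms (RForm Π ι))
    inR? a b = irr a b ∈? atoms (RForm Π ι)

    Xi : Fin n → Fin n → Bool
    Xi a b = ranksBelow a b ∧ ⌊ inR? a b ⌋

    Xi⊆R : IrrSubset Xi (RForm Π ι)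
    Xi⊆R a b Xab = witness (inR? a b) (proj₂ (∧-elim Xab))

    sameOnR : ∀ x → x ∈ atoms (RForm Π ι) → (X ∪ᵢ Xi) x ≡ (X ∪ᵢ ranksBelow) x
    sameOnR (reg _)   _ = refl
    sameOnR (irr a b) m = trans (cong (ranksBelow a b ∧_) (⌊⌋-true (inR? a b) m)) (∧-identityʳ _)

    rformTrue : ⟦ RForm Π ι ⟧ (X ∪ᵢ Xi) ≡ true
    rformTrue = trans (agree (RForm Π ι) _ _ sameOnR)
                      (rform-true ranksBelow (supported-map (⌊⌋-true (_ ℤP.<? _)) sup))

    solves : ∀ a b → irr a b ∈ atoms (IComp Π ι ∧F RForm Π ι) →
             (Xi a b ≡ true → SatCon ν (γR a b)) × (Xi a b ≡ false → ¬ SatCon ν (γR a b))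
    solves a b m = (λ Xab → γR-complete ν (witness (ν b ℤP.<? ν a) (proj₁ (∧-elim Xab))))
                 , (λ ¬Xab sat → not-¬ (Xi-true sat) ¬Xab)
      where
      Xi-true : SatCon ν (γR a b) → Xi a b ≡ true
      Xi-true sat = ∧-intro (⌊⌋-true (ν b ℤP.<? ν a) (γR-sound ν sat))
                            (⌊⌋-true (inR? a b) (irr-in-R Π ι m))

theorem9 : ∀ {n : ℕ} (Π : Program n) (ι : AtomSet n) → HeadsDisjoint Π ι →
           (X : AtomSet n) →
           InputAnswerSet Π ι X ⇔
             (∃[ Xi ] (IrrSubset Xi (RForm Π ι) ×
                       ConstraintModel (IComp Π ι ∧F RForm Π ι) γR (X ∪ᵢ Xi)))
theorem9 Π ι _ X = mk⇔
  (λ answerSet →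
     let (time , supported) = support-from-answerSet Π ι X answerSet
     in model-from-ranking Π ι X (+_ ∘ time) (reduct-holds Π ι X answerSet)
                           (supported-map Π ι X ℤ.+<+ supported))
  (λ model →
     let (sat , ν , supported) = ranking-from-model Π ι X model
     in answerSet-from-support Π ι X (ranking-wellFounded ν) sat supported)
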